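{- Let $G=(V_1\cup V_2,E,\mathit{Wt})$ be an undirected bipartite graph with edge weights $\mathit{Wt}:E\to\mathbb{N}=\{1,2,\dots\}$, with at least one edge. Let $H_1=N$ be the largest edge weight of $G$, and let $H_2<H_1$ be the second largest distinct edge weight of $G$, with $H_2=0$ if all edge weights are equal. Then for every integer $h$ with $1\le h\le H_1-H_2$: (a) the maximum weight matchings of $G_h$ are exactly its maximum cardinality matchings, i.e. $\mathit{mwm}(G_h)=\mathit{mm}(G_h)$; (b) $\mathit{Wt}(\mathit{mwm}(G)) = h\cdot|\mathit{mm}(G_h)| + \mathit{Wt}(\mathit{mwm}(G_h^\Delta))$, where $G_h^\Delta$ is built from an arbitrary minimum weight cover $C_h$ of $G_h$.
   Context: A matching is a set of edges no two sharing a vertex; $\mathit{mm}(H)$ denotes a maximum cardinality matching of a graph $H$, and $\mathit{mwm}(H)$ a maximum weight matching, where the weight of a matching is the sum of its edge weights; $\mathit{Wt}(\mathit{mwm}(H))$ is the maximum weight of a matching of $H$ (equal to $0$ if $H$ has no edges). For an integer $h\in[1,N]$, $G_h$ is the bipartite graph on the same vertex set whose edges are the edges $\{u,v\}$ of $G$ with $\mathit{Wt}(u,v)\in[N-h+1,N]$, each given weight $\mathit{Wt}(u,v)-(N-h)$. A cover of a weighted bipartite graph $H$ with parts $V_1,V_2$ is a function $C:V_1\cup V_2\to\mathbb{N}_0$ with $C(v_1)+C(v_2)\ge \mathit{Wt}(v_1,v_2)$ for every edge $\{v_1,v_2\}$; its weight is $\sum_x C(x)$, and a minimum weight cover is a cover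 of minimum weight. Given a minimum weight cover $C_h$ of $G_h$, $G_h^\Delta$ is the bipartite graph on the same vertex set whose edges are the edges $\{u,v\}$ of $G$ with $\mathit{Wt}(u,v)-C_h(u)-C_h(v)>0$, each given weight $\mathit{Wt}(u,v)-C_h(u)-C_h(v)$. -}

module Defs where

open import Data.Nat using (ℕ; zero; suc; _+_; _*_; _∸_; _≤_; _<_; _<?_)
open import Data.Fin using (Fin)
open import Data.List using (List; map; length; allFin)
open import Data.Nat.ListAction using (sum)
open import Data.List.Membership.Propositional using (_∈_)
open import Data.List.Relation.Unary.All using (All)
open import Data.List.Relation.Unary.Unique.Propositional using (Unique)
open import Data.Product using (Σ; _×_; _,_; proj₁; proj₂; ∃)
open import Relation.Nullary.Decidable using (does)
open import Data.Bool using (if_then_else_)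

-- Since edge weights are
-- positive, W i j ≡ 0 encodes "no edge {i,j}", and W i j > 0 means {i,j} is an
-- edge of weight W i j.
WGraph : ℕ → ℕ → Set
WGraph n₁ n₂ = Fin n₁ → Fin n₂ → ℕ

IsEdge : ∀ {n₁ n₂} → WGraph n₁ n₂ → Fin n₁ × Fin n₂ → Set
IsEdge W (i , j) = 0 < W i j

IsMatching : ∀ {n₁ n₂} → WGraph n₁ n₂ → List (Fin n₁ × Fin n₂) → Set
IsMatching H M = All (IsEdge H) M × Unique (map proj₁ M) × Unique (map proj₂ M)

weight : ∀ {n₁ n₂} → WGraph n₁ n₂ → List (Fin n₁ × Fin n₂) → ℕ
weight H M = sum (map (λ e → H (proj₁ e) (proj₂ e)) M)

IsMWM : ∀ {n₁ n₂} → WGraph n₁ n₂ → List (Fin n₁ × Fin n₂) → Set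
IsMWM H M = IsMatching H M × (∀ M′ → IsMatching H M′ → weight H M′ ≤ weight H M)

IsMM : ∀ {n₁ n₂} → WGraph n₁ n₂ → List (Fin n₁ × Fin n₂) → Set
IsMM H M = IsMatching H M × (∀ M′ → IsMatching H M′ → length M′ ≤ length M)

-- G_h : keep edges with weight in [N-h+1, N], reweighted to W - (N - h).
-- (Used only with 1 ≤ h ≤ N and all weights ≤ N.)
Gh : ∀ {n₁ n₂} → ℕ → ℕ → WGraph n₁ n₂ → WGraph n₁ n₂
Gh N h W i j = if does (N ∸ h <? W i j) then W i j ∸ (N ∸ h) else 0

IsCover : ∀ {n₁ n₂} → WGraph n₁ n₂ → (Fin n₁ → ℕ) → (Fin n₂ → ℕ) → Set
IsCover {n₁} {n₂} H C₁ C₂ = ∀ (i : Fin n₁) (j : Fin n₂) → 0 < H i j → H i j ≤ C₁ i + C₂ j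

coverWeight : ∀ {n₁ n₂} → (Fin n₁ → ℕ) → (Fin n₂ → ℕ) → ℕ
coverWeight {n₁} {n₂} C₁ C₂ = sum (map C₁ (allFin n₁)) + sum (map C₂ (allFin n₂))

IsMinCover : ∀ {n₁ n₂} → WGraph n₁ n₂ → (Fin n₁ → ℕ) → (Fin n₂ → ℕ) → Set
IsMinCover {n₁} {n₂} H C₁ C₂ =
  IsCover H C₁ C₂ ×
  (∀ (D₁ : Fin n₁ → ℕ) (D₂ : Fin n₂ → ℕ) → IsCover H D₁ D₂ → coverWeight C₁ C₂ ≤ coverWeight D₁ D₂)

-- G_h^Δ : edges {u,v} of G with W u v - C(u) - C(v) > 0, weight W u v - C(u) - C(v).
-- (With truncated subtraction, the value is 0 exactly when there is no such edge.)
GΔ : ∀ {n₁ n₂} → WGraph n₁ n₂ → (Fin n₁ → ℕ) → (Fin n₂ → ℕ) → WGraph n₁ n₂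
GΔ W C₁ C₂ i j = W i j ∸ (C₁ i + C₂ j)

-- Egerváry's theorem (the weighted König theorem: a maximum weight matching and a
-- minimum weight cover of a bipartite graph have the same weight) is proved by induction on the
-- total weight.  At a maximum edge (u , v) lower row u by one; an optimal pair for the smaller graph
-- either gains weight in G, or v has a neighbour other than u and its partner x (lower that edge
-- instead), or column v meets only u and x, both at the maximum weight, and u and x can be merged.
--
-- For h ≤ H₁ − H₂ every edge of G_h has weight exactly h, which gives (a).  For (b) let
-- R = Wt(C_h) + Wt(mwm(G_h^Δ)).  Adding to C_h an optimal cover of G_h^Δ yields a cover of G of weight
-- at most R, so Wt(mwm(G)) ≤ R.  Conversely, a cover of G that dominates C_h on one side splits into a
-- cover of G_h plus a cover of G_h^Δ, so it weighs at least R; and for an arbitrary cover D of G and the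
-- cover F above, the two covers (D ⊓ F , D ⊔ F) and (D ⊔ F , D ⊓ F) are of this kind and together weigh
-- Wt(D) + Wt(F) ≤ Wt(D) + R.  Hence every cover of G weighs at least R, and Wt(mwm(G)) = R, while
-- Wt(C_h) = h · |mm(G_h)| by Egerváry's theorem for G_h.

module Submission where

open import Defs
open import Data.Nat using (ℕ; zero; suc; >-nonZero; _+_; _*_; _∸_; _≤_; _<_; z≤n; s≤s; _⊓_; _⊔_; _≤?_; _<?_)
open import Data.Nat.Properties
open import Algebra.Properties.CommutativeSemigroup +-commutativeSemigroup
  using (x∙yz≈y∙xz) renaming (interchange to +-interchange)
open import Algebra.Properties.CommutativeMonoid.Sum +-0-commutativeMonoid
  using (∑-distrib-+; sum-cong-≗; sum-replicate-zero) renaming (sum to ∑)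
open import Data.Fin using (Fin; zero; suc)
open import Data.Fin.Properties using (any?) renaming (_≟_ to _≟ᶠ_)
open import Data.Vec.Functional using (updateAt)
open import Data.Vec.Functional.Properties using (updateAt-updates; updateAt-minimal)
open import Data.List using (List; []; _∷_; map; allFin; tabulate; length)
open import Data.List.Properties using (map-tabulate; map-∘)
open import Data.List.Relation.Unary.All as All using (All; []; _∷_)
open import Data.List.Relation.Unary.All.Properties as Allₚ using (¬Any⇒All¬)
open import Data.List.Relation.Unary.Any as Any using (Any; here; there)
open import Data.List.Relation.Unary.AllPairs as AllPairs using (AllPairs; []; _∷_)
open import Data.List.Relation.Unary.AllPairs.Properties as AllPairsₚ using ()
open import Data.List.Membership.Propositional using (_∈_; find; lose)
open import Data.Nat.ListAction using (sum)
open import Data.Product using (Σ; _×_; _,_; proj₁; proj₂; ∃; ∃₂)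
open import Data.Sum using (_⊎_; inj₁; inj₂; [_,_]′)
open import Data.Empty using (⊥-elim)
open import Relation.Nullary using (¬_; yes; no; Dec; does; ¬?; _×-dec_)
open import Relation.Nullary.Decidable using (dec-true; dec-false)
open import Induction.WellFounded as WF using ()
open import Relation.Binary.Construct.On as On using ()
open import Data.Nat.Induction using (<-wellFounded)
open import Level using (0ℓ)
open import Relation.Binary.PropositionalEquality
open import Function using (_∘_; const)
open import Function.Bundles using (_⇔_; mk⇔; Equivalence)
open import Data.Bool using (if_then_else_)

pred< : ∀ {m} → 0 < m → m ∸ 1 < m
pred< = ∸-monoʳ-< (s≤s z≤n)

≤⊓+ : ∀ {a b d n} → a ≤ b + d → a ≤ n → a ≤ b ⊓ n + d
≤⊓+ {a} {b} {d} {n} a≤b+d a≤n = subst (a ≤_) (sym (+-distribʳ-⊓ d b n)) (⊓-glb a≤b+d (m≤n⇒m≤n+o d a≤n))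

⊓+⊔ : ∀ m n → (m ⊓ n) + (m ⊔ n) ≡ m + n
⊓+⊔ m n with ≤-total m n
... | inj₁ m≤n = cong₂ _+_ (m≤n⇒m⊓n≡m m≤n) (m≤n⇒m⊔n≡n m≤n)
... | inj₂ n≤m = trans (cong₂ _+_ (m≥n⇒m⊓n≡n n≤m) (m≥n⇒m⊔n≡m n≤m)) (+-comm n m)

≤-⊓⊔ : ∀ {w} a b c d → w ≤ a + b → w ≤ c + d → w ≤ (a ⊓ c) + (b ⊔ d)
≤-⊓⊔ {w} a b c d w≤a+b w≤c+d with ≤-total a c
... | inj₁ a≤c = subst (λ t → w ≤ t + (b ⊔ d)) (sym (m≤n⇒m⊓n≡m a≤c)) (≤-trans w≤a+b (+-monoʳ-≤ a (m≤m⊔n b d)))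
... | inj₂ c≤a = subst (λ t → w ≤ t + (b ⊔ d)) (sym (m≥n⇒m⊓n≡n c≤a)) (≤-trans w≤c+d (+-monoʳ-≤ c (m≤n⊔m b d)))

[m+n]∸o≤m+[n∸o] : ∀ m n o → (m + n) ∸ o ≤ m + (n ∸ o)
[m+n]∸o≤m+[n∸o] m n o = m≤n+o⇒m∸n≤o (m + n) o (begin
  m + n             ≤⟨ +-monoʳ-≤ m (m≤n+m∸n n o) ⟩
  m + (o + (n ∸ o)) ≡⟨ x∙yz≈y∙xz m o (n ∸ o) ⟩
  o + (m + (n ∸ o)) ∎)
  where open ≤-Reasoning

≤-split-min : ∀ {h N a b c d} → d ≤ b → h ≤ c + d → N ≤ a + b → h ≤ N →
              h ≤ (c ⊓ a) + (b ∸ ((b ∸ d) ⊓ (N ∸ h)))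
≤-split-min {h} {N} {a} {b} {c} {d} d≤b h≤c+d N≤a+b h≤N with ≤-total c a
... | inj₁ c≤a = begin
  h                                  ≤⟨ h≤c+d ⟩
  c + d                              ≡⟨ cong₂ _+_ (m≤n⇒m⊓n≡m c≤a) (m∸[m∸n]≡n d≤b) ⟨
  (c ⊓ a) + (b ∸ (b ∸ d))            ≤⟨ +-monoʳ-≤ (c ⊓ a) (∸-monoʳ-≤ b (m⊓n≤m (b ∸ d) (N ∸ h))) ⟩
  (c ⊓ a) + (b ∸ ((b ∸ d) ⊓ (N ∸ h))) ∎
  where open ≤-Reasoning
... | inj₂ a≤c = begin
  h                                  ≡⟨ m∸[m∸n]≡n h≤N ⟨
  N ∸ (N ∸ h)                        ≤⟨ ∸-monoˡ-≤ (N ∸ h) N≤a+b ⟩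
  (a + b) ∸ (N ∸ h)                  ≤⟨ [m+n]∸o≤m+[n∸o] a b (N ∸ h) ⟩
  a + (b ∸ (N ∸ h))                  ≡⟨ cong (_+ (b ∸ (N ∸ h))) (m≥n⇒m⊓n≡n a≤c) ⟨
  (c ⊓ a) + (b ∸ (N ∸ h))            ≤⟨ +-monoʳ-≤ (c ⊓ a) (∸-monoʳ-≤ b (m⊓n≤n (b ∸ d) (N ∸ h))) ⟩
  (c ⊓ a) + (b ∸ ((b ∸ d) ⊓ (N ∸ h))) ∎
  where open ≤-Reasoning

∸-split-min : ∀ {w k} a b c d → w ∸ (c + d) ≤ k → w ≤ a + b → w ∸ (c + d) ≤ (a ∸ c) + ((b ∸ d) ⊓ k)
∸-split-min {w} {k} a b c d residual≤k w≤a+b =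
  subst (w ∸ (c + d) ≤_) (sym (+-distribˡ-⊓ (a ∸ c) (b ∸ d) k))
    (⊓-glb (m≤n+o⇒m∸n≤o w (c + d) (begin
              w                               ≤⟨ w≤a+b ⟩
              a + b                           ≤⟨ +-mono-≤ (m≤n+m∸n a c) (m≤n+m∸n b d) ⟩
              (c + (a ∸ c)) + (d + (b ∸ d))   ≡⟨ +-interchange c (a ∸ c) d (b ∸ d) ⟩
              (c + d) + ((a ∸ c) + (b ∸ d))   ∎))
           (≤-trans residual≤k (m≤n+m k (a ∸ c))))
  where open ≤-Reasoning

_[_]≔_ : ∀ {A : Set} {n} → (Fin n → A) → Fin n → A → Fin n → A
f [ p ]≔ a = updateAt f p (const a)

∑-tabulate : ∀ {n} (f : Fin n → ℕ) → sum (tabulate f) ≡ ∑ f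
∑-tabulate {zero} f = refl
∑-tabulate {suc n} f = cong (f zero +_) (∑-tabulate (f ∘ suc))

∑-allFin : ∀ {n} (f : Fin n → ℕ) → sum (map f (allFin n)) ≡ ∑ f
∑-allFin f = trans (cong sum (map-tabulate (λ i → i) f)) (∑-tabulate f)

∑-mono-≤ : ∀ {n} {f g : Fin n → ℕ} → (∀ i → f i ≤ g i) → ∑ f ≤ ∑ g
∑-mono-≤ {zero} _ = z≤n
∑-mono-≤ {suc n} f≤g = +-mono-≤ (f≤g zero) (∑-mono-≤ (f≤g ∘ suc))

∑-mono-< : ∀ {n} {f g : Fin n → ℕ} p → (∀ i → f i ≤ g i) → f p < g p → ∑ f < ∑ g
∑-mono-< zero f≤g fp<gp = +-mono-<-≤ fp<gp (∑-mono-≤ (f≤g ∘ suc))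
∑-mono-< (suc p) f≤g fp<gp = +-mono-≤-< (f≤g zero) (∑-mono-< p (f≤g ∘ suc) fp<gp)

∑-[]≔ : ∀ {n} (f : Fin n → ℕ) p a → ∑ (f [ p ]≔ a) + f p ≡ ∑ f + a
∑-[]≔ f zero a = begin
  a + ∑ (f ∘ suc) + f zero   ≡⟨ +-comm (a + ∑ (f ∘ suc)) (f zero) ⟩
  f zero + (a + ∑ (f ∘ suc)) ≡⟨ cong (f zero +_) (+-comm a _) ⟩
  f zero + (∑ (f ∘ suc) + a) ≡⟨ +-assoc (f zero) _ a ⟨
  f zero + ∑ (f ∘ suc) + a   ∎
  where open ≡-Reasoning
∑-[]≔ f (suc p) a = begin
  f zero + ∑ ((f ∘ suc) [ p ]≔ a) + f (suc p)   ≡⟨ +-assoc (f zero) _ _ ⟩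
  f zero + (∑ ((f ∘ suc) [ p ]≔ a) + f (suc p)) ≡⟨ cong (f zero +_) (∑-[]≔ (f ∘ suc) p a) ⟩
  f zero + (∑ (f ∘ suc) + a)                    ≡⟨ +-assoc (f zero) _ a ⟨
  f zero + ∑ (f ∘ suc) + a                      ∎
  where open ≡-Reasoning

∑-[]≔0 : ∀ {n} (f : Fin n → ℕ) p → ∑ f ≡ f p + ∑ (f [ p ]≔ 0)
∑-[]≔0 f p = trans (sym (trans (∑-[]≔ f p 0) (+-identityʳ (∑ f)))) (+-comm _ (f p))

∑-[]≔suc : ∀ {n} (f : Fin n → ℕ) p → ∑ (f [ p ]≔ suc (f p)) ≡ suc (∑ f)
∑-[]≔suc f p = +-cancelʳ-≡ (f p) _ _ (trans (∑-[]≔ f p (suc (f p))) (+-suc (∑ f) (f p)))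

∑-[]≔-≤ : ∀ {n} (f : Fin n → ℕ) p a → ∑ (f [ p ]≔ a) ≤ ∑ f + a
∑-[]≔-≤ f p a = ≤-trans (m≤m+n _ (f p)) (≤-reflexive (∑-[]≔ f p a))

∑-mono-<₂ : ∀ {n} {f g : Fin n → ℕ} {u x} → x ≢ u → (∀ i → i ≢ u → i ≢ x → f i ≤ g i) →
            f u + f x < g u + g x → ∑ f < ∑ g
∑-mono-<₂ {n} {f} {g} {u} {x} x≢u f≤g <ᵤₓ = begin-strict
  ∑ f                  ≡⟨ split f ⟩
  f u + f x + ∑ (rest f) <⟨ +-mono-<-≤ <ᵤₓ (∑-mono-≤ rest-≤) ⟩
  g u + g x + ∑ (rest g) ≡⟨ split g ⟨
  ∑ g                  ∎
  where
  open ≤-Reasoning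
  rest : (Fin n → ℕ) → Fin n → ℕ
  rest h = (h [ u ]≔ 0) [ x ]≔ 0
  split : ∀ h → ∑ h ≡ h u + h x + ∑ (rest h)
  split h = trans (∑-[]≔0 h u) (trans (cong (h u +_) (∑-[]≔0 (h [ u ]≔ 0) x))
              (trans (cong (λ t → h u + (t + ∑ (rest h))) (updateAt-minimal x u h x≢u)) (sym (+-assoc (h u) _ _))))
  rest-≤ : ∀ i → rest f i ≤ rest g i
  rest-≤ i with i ≟ᶠ x | i ≟ᶠ u
  ... | yes refl | _ = ≤-reflexive (trans (updateAt-updates i _) (sym (updateAt-updates i _)))
  ... | no i≢x | yes refl = subst₂ _≤_ (sym (trans (updateAt-minimal i x _ i≢x) (updateAt-updates i f)))
                              (sym (trans (updateAt-minimal i x _ i≢x) (updateAt-updates i g))) z≤n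
  ... | no i≢x | no i≢u = subst₂ _≤_ (sym (trans (updateAt-minimal i x _ i≢x) (updateAt-minimal i u f i≢u)))
                              (sym (trans (updateAt-minimal i x _ i≢x) (updateAt-minimal i u g i≢u))) (f≤g i i≢u i≢x)

sum-map-mono-≤ : ∀ {A : Set} {f g : A → ℕ} {xs} → All (λ x → f x ≤ g x) xs → sum (map f xs) ≤ sum (map g xs)
sum-map-mono-≤ [] = z≤n
sum-map-mono-≤ (f≤g ∷ fs≤gs) = +-mono-≤ f≤g (sum-map-mono-≤ fs≤gs)

sum-map-mono-< : ∀ {A : Set} {f g : A → ℕ} {xs} → All (λ x → f x ≤ g x) xs → Any (λ x → f x < g x) xs →
                 sum (map f xs) < sum (map g xs)
sum-map-mono-< (_ ∷ fs≤gs) (here f<g) = +-mono-<-≤ f<g (sum-map-mono-≤ fs≤gs)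
sum-map-mono-< (f≤g ∷ fs≤gs) (there fs<gs) = +-mono-≤-< f≤g (sum-map-mono-< fs≤gs fs<gs)

AllPairs-∈ : ∀ {A : Set} {R : A → A → Set} {xs a b} → AllPairs R xs → a ∈ xs → b ∈ xs → a ≡ b ⊎ R a b ⊎ R b a
AllPairs-∈ (_ ∷ _) (here refl) (here refl) = inj₁ refl
AllPairs-∈ (Rx ∷ _) (here refl) (there b∈) = inj₂ (inj₁ (All.lookup Rx b∈))
AllPairs-∈ (Rx ∷ _) (there a∈) (here refl) = inj₂ (inj₂ (All.lookup Rx a∈))
AllPairs-∈ (_ ∷ Rxs) (there a∈) (there b∈) = AllPairs-∈ Rxs a∈ b∈

argmax : ∀ {m} (f : Fin (suc m) → ℕ) → ∃ λ p → ∀ i → f i ≤ f p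
argmax {zero} f = zero , λ { zero → ≤-refl }
argmax {suc m} f with argmax (f ∘ suc)
... | p , max with f zero ≤? f (suc p)
...   | yes f₀≤ = suc p , λ { zero → f₀≤ ; (suc i) → max i }
...   | no f₀≰ = zero , λ { zero → ≤-refl ; (suc i) → ≤-trans (max i) (<⇒≤ (≰⇒> f₀≰)) }

-- Matchings and covers

module _ {n₁ n₂ : ℕ} where

  coverWeight-∑ : (D₁ : Fin n₁ → ℕ) (D₂ : Fin n₂ → ℕ) → coverWeight D₁ D₂ ≡ ∑ D₁ + ∑ D₂
  coverWeight-∑ D₁ D₂ = cong₂ _+_ (∑-allFin D₁) (∑-allFin D₂)

  coverWeight-cong : ∀ {A₁ B₁ : Fin n₁ → ℕ} {A₂ B₂ : Fin n₂ → ℕ} →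
                     (∀ u → A₁ u ≡ B₁ u) → (∀ v → A₂ v ≡ B₂ v) → coverWeight A₁ A₂ ≡ coverWeight B₁ B₂
  coverWeight-cong {A₁} {B₁} {A₂} {B₂} e₁ e₂ = begin
    coverWeight A₁ A₂ ≡⟨ coverWeight-∑ A₁ A₂ ⟩
    ∑ A₁ + ∑ A₂       ≡⟨ cong₂ _+_ (sum-cong-≗ e₁) (sum-cong-≗ e₂) ⟩
    ∑ B₁ + ∑ B₂       ≡⟨ coverWeight-∑ B₁ B₂ ⟨
    coverWeight B₁ B₂ ∎
    where open ≡-Reasoning

  coverWeight-+ : (P₁ Q₁ : Fin n₁ → ℕ) (P₂ Q₂ : Fin n₂ → ℕ) →
                  coverWeight (λ u → P₁ u + Q₁ u) (λ v → P₂ v + Q₂ v) ≡ coverWeight P₁ P₂ + coverWeight Q₁ Q₂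
  coverWeight-+ P₁ Q₁ P₂ Q₂ = begin
    coverWeight (λ u → P₁ u + Q₁ u) (λ v → P₂ v + Q₂ v) ≡⟨ coverWeight-∑ _ _ ⟩
    ∑ (λ u → P₁ u + Q₁ u) + ∑ (λ v → P₂ v + Q₂ v)      ≡⟨ cong₂ _+_ (∑-distrib-+ P₁ Q₁) (∑-distrib-+ P₂ Q₂) ⟩
    (∑ P₁ + ∑ Q₁) + (∑ P₂ + ∑ Q₂)                      ≡⟨ +-interchange (∑ P₁) (∑ Q₁) (∑ P₂) (∑ Q₂) ⟩
    (∑ P₁ + ∑ P₂) + (∑ Q₁ + ∑ Q₂)                      ≡⟨ cong₂ _+_ (coverWeight-∑ P₁ P₂) (coverWeight-∑ Q₁ Q₂) ⟨
    coverWeight P₁ P₂ + coverWeight Q₁ Q₂              ∎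
    where open ≡-Reasoning

  Edge : Set
  Edge = Fin n₁ × Fin n₂

  wt : WGraph n₁ n₂ → Edge → ℕ
  wt K e = K (proj₁ e) (proj₂ e)

  Disjoint : Edge → Edge → Set
  Disjoint e e′ = proj₁ e ≢ proj₁ e′ × proj₂ e ≢ proj₂ e′

  Matching : WGraph n₁ n₂ → List Edge → Set
  Matching K M = All (IsEdge K) M × AllPairs Disjoint M

  isMatching⇒matching : ∀ {K M} → IsMatching K M → Matching K M
  isMatching⇒matching (edges , unique₁ , unique₂) =
    edges , AllPairs.zip (AllPairsₚ.map⁻ unique₁ , AllPairsₚ.map⁻ unique₂)

  matching⇒isMatching : ∀ {K M} → Matching K M → IsMatching K M
  matching⇒isMatching (edges , disjoint) with AllPairs.unzip disjoint
  ... | unique₁ , unique₂ = edges , AllPairsₚ.map⁺ unique₁ , AllPairsₚ.map⁺ unique₂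

  CoveredBy : WGraph n₁ n₂ → (Fin n₁ → ℕ) → (Fin n₂ → ℕ) → Edge → Set
  CoveredBy K D₁ D₂ e = wt K e ≤ D₁ (proj₁ e) + D₂ (proj₂ e)

  weight≤∑ : ∀ {K M} D₁ D₂ → AllPairs Disjoint M → All (CoveredBy K D₁ D₂) M → weight K M ≤ ∑ D₁ + ∑ D₂
  weight≤∑ D₁ D₂ [] [] = z≤n
  weight≤∑ {K} {(a , b) ∷ M} D₁ D₂ (disj ∷ disjs) (cov ∷ covs) = begin
    wt K (a , b) + weight K M
      ≤⟨ +-mono-≤ cov (weight≤∑ (D₁ [ a ]≔ 0) (D₂ [ b ]≔ 0) disjs (All.zipWith uncover (disj , covs))) ⟩
    (D₁ a + D₂ b) + (∑ (D₁ [ a ]≔ 0) + ∑ (D₂ [ b ]≔ 0))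
      ≡⟨ +-interchange (D₁ a) (D₂ b) _ _ ⟩
    (D₁ a + ∑ (D₁ [ a ]≔ 0)) + (D₂ b + ∑ (D₂ [ b ]≔ 0))
      ≡⟨ cong₂ _+_ (∑-[]≔0 D₁ a) (∑-[]≔0 D₂ b) ⟨
    ∑ D₁ + ∑ D₂ ∎
    where
    open ≤-Reasoning
    uncover : ∀ {e} → Disjoint (a , b) e × CoveredBy K D₁ D₂ e → CoveredBy K (D₁ [ a ]≔ 0) (D₂ [ b ]≔ 0) e
    uncover {e} ((a≢ , b≢) , c) =
      subst (wt K e ≤_) (sym (cong₂ _+_ (updateAt-minimal _ a D₁ (a≢ ∘ sym)) (updateAt-minimal _ b D₂ (b≢ ∘ sym)))) c

  coveredEdges : ∀ {K M} D₁ D₂ → IsCover K D₁ D₂ → All (IsEdge K) M → All (CoveredBy K D₁ D₂) M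
  coveredEdges _ _ cover = All.map (λ {e} → cover (proj₁ e) (proj₂ e))

  weakDuality : ∀ {K M D₁ D₂} → Matching K M → IsCover K D₁ D₂ → weight K M ≤ coverWeight D₁ D₂
  weakDuality {K} {M} {D₁} {D₂} (edges , disjoint) cover =
    subst (weight K M ≤_) (sym (coverWeight-∑ D₁ D₂)) (weight≤∑ D₁ D₂ disjoint (coveredEdges D₁ D₂ cover edges))

  weakDuality-unmatched : ∀ {K M D₁ D₂} u → Matching K M → IsCover K D₁ D₂ → All (λ e → proj₁ e ≢ u) M →
                          weight K M + D₁ u ≤ coverWeight D₁ D₂
  weakDuality-unmatched {K} {M} {D₁} {D₂} u (edges , disjoint) cover unmatched = begin
    weight K M + D₁ u                 ≤⟨ +-monoˡ-≤ (D₁ u) (weight≤∑ (D₁ [ u ]≔ 0) D₂ disjoint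
                                           (All.zipWith uncover (unmatched , coveredEdges D₁ D₂ cover edges))) ⟩
    ∑ (D₁ [ u ]≔ 0) + ∑ D₂ + D₁ u     ≡⟨ +-assoc (∑ (D₁ [ u ]≔ 0)) _ _ ⟩
    ∑ (D₁ [ u ]≔ 0) + (∑ D₂ + D₁ u)   ≡⟨ cong (∑ (D₁ [ u ]≔ 0) +_) (+-comm (∑ D₂) (D₁ u)) ⟩
    ∑ (D₁ [ u ]≔ 0) + (D₁ u + ∑ D₂)   ≡⟨ +-assoc (∑ (D₁ [ u ]≔ 0)) _ _ ⟨
    ∑ (D₁ [ u ]≔ 0) + D₁ u + ∑ D₂     ≡⟨ cong (_+ ∑ D₂) (trans (+-comm _ (D₁ u)) (sym (∑-[]≔0 D₁ u))) ⟩
    ∑ D₁ + ∑ D₂                       ≡⟨ coverWeight-∑ D₁ D₂ ⟨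
    coverWeight D₁ D₂ ∎
    where
    open ≤-Reasoning
    uncover : ∀ {e} → proj₁ e ≢ u × CoveredBy K D₁ D₂ e → CoveredBy K (D₁ [ u ]≔ 0) D₂ e
    uncover {e} (≢u , c) = subst (wt K e ≤_) (cong (_+ D₂ (proj₂ e)) (sym (updateAt-minimal _ u D₁ ≢u))) c

  matched₁-unique : ∀ {M a b} → AllPairs Disjoint M → a ∈ M → b ∈ M → proj₁ a ≡ proj₁ b → a ≡ b
  matched₁-unique disjoint a∈ b∈ a₁≡b₁ with AllPairs-∈ disjoint a∈ b∈
  ... | inj₁ a≡b = a≡b
  ... | inj₂ (inj₁ (a₁≢b₁ , _)) = ⊥-elim (a₁≢b₁ a₁≡b₁)
  ... | inj₂ (inj₂ (b₁≢a₁ , _)) = ⊥-elim (b₁≢a₁ (sym a₁≡b₁))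

  matched₂-unique : ∀ {M a b} → AllPairs Disjoint M → a ∈ M → b ∈ M → proj₂ a ≡ proj₂ b → a ≡ b
  matched₂-unique disjoint a∈ b∈ a₂≡b₂ with AllPairs-∈ disjoint a∈ b∈
  ... | inj₁ a≡b = a≡b
  ... | inj₂ (inj₁ (_ , a₂≢b₂)) = ⊥-elim (a₂≢b₂ a₂≡b₂)
  ... | inj₂ (inj₂ (_ , b₂≢a₂)) = ⊥-elim (b₂≢a₂ (sym a₂≡b₂))

  covers : ∀ {K : WGraph n₁ n₂} D₁ D₂ → IsCover K D₁ D₂ → ∀ i j → K i j ≤ D₁ i + D₂ j
  covers {K} _ _ cover i j with 0 <? K i j
  ... | yes Kij>0 = cover i j Kij>0
  ... | no Kij≯0 = subst (_≤ _) (sym (n≤0⇒n≡0 (≮⇒≥ Kij≯0))) z≤n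

  uniform-mwm⇔mm : ∀ {K : WGraph n₁ n₂} {h} → 1 ≤ h → (∀ M → All (IsEdge K) M → weight K M ≡ h * length M) →
                   ∀ M → IsMWM K M ⇔ IsMM K M
  uniform-mwm⇔mm {K} {h} h≥1 uniform M = mk⇔
    (λ (isM , optimal) → isM , λ M′ isM′ → *-cancelˡ-≤ h {{>-nonZero h≥1}}
      (subst₂ _≤_ (uniform M′ (proj₁ isM′)) (uniform M (proj₁ isM)) (optimal M′ isM′)))
    (λ (isM , maximum) → isM , λ M′ isM′ →
      subst₂ _≤_ (sym (uniform M′ (proj₁ isM′))) (sym (uniform M (proj₁ isM))) (*-monoʳ-≤ h (maximum M′ isM′)))

  cover-⊓⊔ : ∀ {K : WGraph n₁ n₂} D₁ D₂ F₁ F₂ → IsCover K D₁ D₂ → IsCover K F₁ F₂ →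
             IsCover K (λ u → D₁ u ⊓ F₁ u) (λ v → D₂ v ⊔ F₂ v)
  cover-⊓⊔ D₁ D₂ F₁ F₂ coverD coverF i j Kij>0 = ≤-⊓⊔ (D₁ i) (D₂ j) (F₁ i) (F₂ j) (coverD i j Kij>0) (coverF i j Kij>0)

  cover-⊔⊓ : ∀ {K : WGraph n₁ n₂} D₁ D₂ F₁ F₂ → IsCover K D₁ D₂ → IsCover K F₁ F₂ →
             IsCover K (λ u → D₁ u ⊔ F₁ u) (λ v → D₂ v ⊓ F₂ v)
  cover-⊔⊓ {K} D₁ D₂ F₁ F₂ coverD coverF i j Kij>0 =
    subst (K i j ≤_) (+-comm (D₂ j ⊓ F₂ j) (D₁ i ⊔ F₁ i))
      (≤-⊓⊔ (D₂ j) (D₁ i) (F₂ j) (F₁ i) (subst (K i j ≤_) (+-comm (D₁ i) (D₂ j)) (coverD i j Kij>0))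
            (subst (K i j ≤_) (+-comm (F₁ i) (F₂ j)) (coverF i j Kij>0)))

  coverWeight-⊓⊔ : (D₁ F₁ : Fin n₁ → ℕ) (D₂ F₂ : Fin n₂ → ℕ) →
                   coverWeight (λ u → D₁ u ⊓ F₁ u) (λ v → D₂ v ⊔ F₂ v) +
                   coverWeight (λ u → D₁ u ⊔ F₁ u) (λ v → D₂ v ⊓ F₂ v) ≡ coverWeight D₁ D₂ + coverWeight F₁ F₂
  coverWeight-⊓⊔ D₁ F₁ D₂ F₂ = begin
    coverWeight (λ u → D₁ u ⊓ F₁ u) (λ v → D₂ v ⊔ F₂ v) + coverWeight (λ u → D₁ u ⊔ F₁ u) (λ v → D₂ v ⊓ F₂ v)
      ≡⟨ coverWeight-+ (λ u → D₁ u ⊓ F₁ u) (λ u → D₁ u ⊔ F₁ u) (λ v → D₂ v ⊔ F₂ v) (λ v → D₂ v ⊓ F₂ v) ⟨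
    coverWeight (λ u → (D₁ u ⊓ F₁ u) + (D₁ u ⊔ F₁ u)) (λ v → (D₂ v ⊔ F₂ v) + (D₂ v ⊓ F₂ v))
      ≡⟨ coverWeight-cong (λ u → ⊓+⊔ (D₁ u) (F₁ u)) (λ v → trans (+-comm (D₂ v ⊔ F₂ v) _) (⊓+⊔ (D₂ v) (F₂ v))) ⟩
    coverWeight (λ u → D₁ u + F₁ u) (λ v → D₂ v + F₂ v)
      ≡⟨ coverWeight-+ D₁ F₁ D₂ F₂ ⟩
    coverWeight D₁ D₂ + coverWeight F₁ F₂ ∎
    where open ≡-Reasoning

  residual-cover : ∀ {W : WGraph n₁ n₂} C₁ C₂ Q₁ Q₂ → IsCover (GΔ W C₁ C₂) Q₁ Q₂ →
                   IsCover W (λ u → C₁ u + Q₁ u) (λ v → C₂ v + Q₂ v)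
  residual-cover {W} C₁ C₂ Q₁ Q₂ coverQ i j _ = begin
    W i j                                   ≤⟨ m≤n+m∸n (W i j) (C₁ i + C₂ j) ⟩
    (C₁ i + C₂ j) + (W i j ∸ (C₁ i + C₂ j)) ≤⟨ +-monoʳ-≤ (C₁ i + C₂ j) (covers Q₁ Q₂ coverQ i j) ⟩
    (C₁ i + C₂ j) + (Q₁ i + Q₂ j)           ≡⟨ +-interchange (C₁ i) (C₂ j) (Q₁ i) (Q₂ j) ⟩
    (C₁ i + Q₁ i) + (C₂ j + Q₂ j)           ∎
    where open ≤-Reasoning

-- Egerváry's theorem

maxEdge : ∀ {n₁ n₂} (K : WGraph n₁ n₂) →
          (∀ i j → K i j ≡ 0) ⊎ ∃₂ λ u v → 0 < K u v × (∀ i j → K i j ≤ K u v)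
maxEdge {zero} K = inj₁ λ ()
maxEdge {suc _} {zero} K = inj₁ λ _ ()
maxEdge {suc n₁} {suc n₂} K = decide (0 <? K u v)
  where
  rowMax : ∀ i → ∃ λ j → ∀ j′ → K i j′ ≤ K i j
  rowMax i = argmax (K i)
  u : Fin (suc n₁)
  u = proj₁ (argmax λ i → K i (proj₁ (rowMax i)))
  v : Fin (suc n₂)
  v = proj₁ (rowMax u)
  below : ∀ i j → K i j ≤ K u v
  below i j = ≤-trans (proj₂ (rowMax i) j) (proj₂ (argmax λ i → K i (proj₁ (rowMax i))) i)
  decide : Dec (0 < K u v) → (∀ i j → K i j ≡ 0) ⊎ ∃₂ λ u v → 0 < K u v × (∀ i j → K i j ≤ K u v)
  decide (yes Kuv>0) = inj₂ (u , v , Kuv>0 , below)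
  decide (no Kuv≯0) = inj₁ λ i j → n≤0⇒n≡0 (≤-trans (below i j) (≮⇒≥ Kuv≯0))

module _ {n₁ n₂ : ℕ} where

  _⊑_ : WGraph n₁ n₂ → WGraph n₁ n₂ → Set
  K′ ⊑ K = ∀ i j → K′ i j ≤ K i j

  matching-⊑ : ∀ {K′ K M} → K′ ⊑ K → Matching K′ M → Matching K M
  matching-⊑ K′⊑K (edges , disjoint) = All.map (λ {e} p → <-≤-trans p (K′⊑K (proj₁ e) (proj₂ e))) edges , disjoint

  weight-⊑ : ∀ {K′ K} → K′ ⊑ K → ∀ M → weight K′ M ≤ weight K M
  weight-⊑ K′⊑K M = sum-map-mono-≤ (All.tabulate {xs = M} λ {e} _ → K′⊑K (proj₁ e) (proj₂ e))

  totalWeight : WGraph n₁ n₂ → ℕ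
  totalWeight K = ∑ λ i → ∑ (K i)

  totalWeight-< : ∀ {K′ K} u v → K′ ⊑ K → K′ u v < K u v → totalWeight K′ < totalWeight K
  totalWeight-< u v K′⊑K <ᵤᵥ = ∑-mono-< u (λ i → ∑-mono-≤ (K′⊑K i)) (∑-mono-< v (K′⊑K u) <ᵤᵥ)

  -- By weak duality both halves of a tight pair are optimal.
  record TightPair (K : WGraph n₁ n₂) : Set where
    constructor tightPair
    field
      matching : List Edge
      cover₁ : Fin n₁ → ℕ
      cover₂ : Fin n₂ → ℕ
      isMatching : Matching K matching
      isCover : IsCover K cover₁ cover₂
      tight : coverWeight cover₁ cover₂ ≤ weight K matching

  tightPair-empty : ∀ {K} → (∀ i j → K i j ≡ 0) → TightPair K
  tightPair-empty K≡0 = tightPair [] (const 0) (const 0) ([] , [])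
    (λ i j Kij>0 → ⊥-elim (<-irrefl (sym (K≡0 i j)) Kij>0))
    (≤-reflexive (trans (coverWeight-∑ {n₁} {n₂} (const 0) (const 0))
                        (cong₂ _+_ (sum-replicate-zero n₁) (sum-replicate-zero n₂))))

  redirect : Fin n₁ → Fin n₂ → Edge → Edge
  redirect p y e = if does (proj₂ e ≟ᶠ y) then (p , y) else e

  redirect-disjoint : ∀ {p y M} → All (λ e → proj₁ e ≡ p → proj₂ e ≡ y) M → AllPairs Disjoint M →
                      AllPairs Disjoint (map (redirect p y) M)
  redirect-disjoint [] [] = []
  redirect-disjoint (pa ∷ ps) (da ∷ ds) =
    Allₚ.map⁺ (All.zipWith (λ (pb , dab) → redirect-pair pa pb dab) (ps , da)) ∷ redirect-disjoint ps ds
    where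
    redirect-pair : ∀ {p y a b} → (proj₁ a ≡ p → proj₂ a ≡ y) → (proj₁ b ≡ p → proj₂ b ≡ y) →
                    Disjoint a b → Disjoint (redirect p y a) (redirect p y b)
    redirect-pair {p} {y} {a} {b} pa pb (a₁≢b₁ , a₂≢b₂) with proj₂ a ≟ᶠ y | proj₂ b ≟ᶠ y
    ... | yes a₂≡y | yes b₂≡y = ⊥-elim (a₂≢b₂ (trans a₂≡y (sym b₂≡y)))
    ... | yes _    | no b₂≢y  = (λ p≡b₁ → b₂≢y (pb (sym p≡b₁))) , (λ y≡b₂ → b₂≢y (sym y≡b₂))
    ... | no a₂≢y  | yes _    = (λ a₁≡p → a₂≢y (pa a₁≡p)) , a₂≢y
    ... | no _     | no _     = a₁≢b₁ , a₂≢b₂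

  decEdge : Fin n₁ → Fin n₂ → WGraph n₁ n₂ → WGraph n₁ n₂
  decEdge y v K = K [ y ]≔ (K y [ v ]≔ (K y v ∸ 1))

  decEdge-at : ∀ y v K → decEdge y v K y v ≡ K y v ∸ 1
  decEdge-at y v K = trans (cong-app (updateAt-updates y K) v) (updateAt-updates v (K y))

  decEdge-off : ∀ {y v} K i j → ¬ (i ≡ y × j ≡ v) → decEdge y v K i j ≡ K i j
  decEdge-off {y} {v} K i j ≢yv with i ≟ᶠ y
  ... | yes refl = trans (cong-app (updateAt-updates i K) j) (updateAt-minimal j v (K i) λ j≡v → ≢yv (refl , j≡v))
  ... | no i≢y = cong-app (updateAt-minimal i y K i≢y) j

  decEdge-⊑ : ∀ y v K → decEdge y v K ⊑ K
  decEdge-⊑ y v K i j with i ≟ᶠ y | j ≟ᶠ v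
  ... | yes refl | yes refl = subst (_≤ K i j) (sym (decEdge-at i j K)) (m∸n≤m (K i j) 1)
  ... | yes _    | no j≢v  = ≤-reflexive (decEdge-off K i j (j≢v ∘ proj₂))
  ... | no i≢y   | _       = ≤-reflexive (decEdge-off K i j (i≢y ∘ proj₁))

  decEdge-< : ∀ {y v} K → 0 < K y v → totalWeight (decEdge y v K) < totalWeight K
  decEdge-< {y} {v} K Kyv>0 =
    totalWeight-< y v (decEdge-⊑ y v K) (subst (_< K y v) (sym (decEdge-at y v K)) (pred< Kyv>0))

  module MaxEdge (K : WGraph n₁ n₂) {u v} (Kuv>0 : 0 < K u v) (Kuv-max : ∀ i j → K i j ≤ K u v) where

    Ku : WGraph n₁ n₂
    Ku = K [ u ]≔ (λ j → K u j ∸ 1)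

    Ku-other : ∀ {i} j → i ≢ u → Ku i j ≡ K i j
    Ku-other j i≢u = cong-app (updateAt-minimal _ u K i≢u) j

    Ku-on-row : ∀ {i} j → i ≡ u → Ku i j ≡ K i j ∸ 1
    Ku-on-row j refl = cong-app (updateAt-updates u K) j

    Ku⊑K : Ku ⊑ K
    Ku⊑K i j with i ≟ᶠ u
    ... | yes i≡u = subst (_≤ K i j) (sym (Ku-on-row j i≡u)) (m∸n≤m (K i j) 1)
    ... | no i≢u = ≤-reflexive (Ku-other j i≢u)

    Ku<K-on-row : ∀ {i} j → i ≡ u → 0 < Ku i j → Ku i j < K i j
    Ku<K-on-row {i} j i≡u Kuij>0 = subst (_< K i j) (sym (Ku-on-row j i≡u)) (pred< (<-≤-trans Kuij>0 (Ku⊑K i j)))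

    Ku<K : totalWeight Ku < totalWeight K
    Ku<K = totalWeight-< u v Ku⊑K (subst (_< K u v) (sym (Ku-on-row v refl)) (pred< Kuv>0))

    module FromDecremented (T : TightPair Ku) where
      open TightPair T renaming (matching to Mu)

      raise : ∀ M → Matching K M → weight Ku Mu < weight K M → TightPair K
      raise M isMatchingM heavier = tightPair M (cover₁ [ u ]≔ suc (cover₁ u)) cover₂ isMatchingM raised tight′
        where
        raised : IsCover K (cover₁ [ u ]≔ suc (cover₁ u)) cover₂
        raised i j _ with i ≟ᶠ u
        ... | yes refl = subst (λ c → K i j ≤ c + cover₂ j) (sym (updateAt-updates i cover₁))
                           (≤-trans (m≤n+m∸n (K i j) 1)
                              (+-monoʳ-≤ 1 (subst (_≤ _) (Ku-on-row j refl) (covers cover₁ cover₂ isCover i j))))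
        ... | no i≢u = subst₂ (λ w c → w ≤ c + cover₂ j) (Ku-other j i≢u) (sym (updateAt-minimal i u cover₁ i≢u))
                         (covers cover₁ cover₂ isCover i j)
        tight′ : coverWeight (cover₁ [ u ]≔ suc (cover₁ u)) cover₂ ≤ weight K M
        tight′ = begin
          coverWeight (cover₁ [ u ]≔ suc (cover₁ u)) cover₂ ≡⟨ coverWeight-∑ (cover₁ [ u ]≔ suc (cover₁ u)) cover₂ ⟩
          ∑ (cover₁ [ u ]≔ suc (cover₁ u)) + ∑ cover₂      ≡⟨ cong (_+ ∑ cover₂) (∑-[]≔suc cover₁ u) ⟩
          suc (∑ cover₁ + ∑ cover₂)                        ≡⟨ cong suc (coverWeight-∑ cover₁ cover₂) ⟨
          suc (coverWeight cover₁ cover₂)                  ≤⟨ s≤s tight ⟩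
          suc (weight Ku Mu)                               ≤⟨ heavier ⟩
          weight K M                                       ∎
          where open ≤-Reasoning

      u-matched : Any (λ e → proj₁ e ≡ u) Mu → TightPair K
      u-matched u∈ with find u∈
      ... | (a , b) , ab∈ , a≡u = raise Mu (matching-⊑ Ku⊑K isMatching)
            (sum-map-mono-< (All.tabulate λ {e} _ → Ku⊑K (proj₁ e) (proj₂ e))
                            (lose ab∈ (Ku<K-on-row b a≡u (All.lookup (proj₁ isMatching) ab∈))))

      u-v-unmatched : ¬ Any (λ e → proj₁ e ≡ u) Mu → ¬ Any (λ e → proj₂ e ≡ v) Mu → TightPair K
      u-v-unmatched u∉ v∉ = raise ((u , v) ∷ Mu)
        (Kuv>0 ∷ proj₁ (matching-⊑ Ku⊑K isMatching) ,
         All.zipWith (λ (≢u , ≢v) → ≢u ∘ sym , ≢v ∘ sym) (¬Any⇒All¬ Mu u∉ , ¬Any⇒All¬ Mu v∉) ∷ proj₂ isMatching)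
        (+-mono-≤ Kuv>0 (weight-⊑ Ku⊑K Mu))

      module _ (u∉ : ¬ Any (λ e → proj₁ e ≡ u) Mu) {x} (xv∈ : (x , v) ∈ Mu) where

        u-unmatched : All (λ e → proj₁ e ≢ u) Mu
        u-unmatched = ¬Any⇒All¬ Mu u∉

        x≢u : x ≢ u
        x≢u = All.lookup u-unmatched xv∈

        partner-lighter : K x v < K u v → TightPair K
        partner-lighter Kxv<Kuv = raise (map (redirect u v) Mu)
          (Allₚ.map⁺ (All.tabulate edge) ,
           redirect-disjoint (All.map (λ ≢u ≡u → ⊥-elim (≢u ≡u)) u-unmatched) (proj₂ isMatching))
          (subst (weight Ku Mu <_) (cong sum (map-∘ {g = wt K} {f = redirect u v} Mu))
            (sum-map-mono-< (All.tabulate λ {e} _ → gain e) (lose xv∈ strict)))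
          where
          edge : ∀ {e} → e ∈ Mu → IsEdge K (redirect u v e)
          edge {e} e∈ with proj₂ e ≟ᶠ v
          ... | yes _ = Kuv>0
          ... | no _ = <-≤-trans (All.lookup (proj₁ isMatching) e∈) (Ku⊑K (proj₁ e) (proj₂ e))
          gain : ∀ e → wt Ku e ≤ wt K (redirect u v e)
          gain e with proj₂ e ≟ᶠ v
          ... | yes _ = ≤-trans (Ku⊑K (proj₁ e) (proj₂ e)) (Kuv-max (proj₁ e) (proj₂ e))
          ... | no _ = Ku⊑K (proj₁ e) (proj₂ e)
          strict : wt Ku (x , v) < wt K (redirect u v (x , v))
          strict with v ≟ᶠ v
          ... | yes _ = subst (_< K u v) (sym (Ku-other v x≢u)) Kxv<Kuv
          ... | no v≢v = ⊥-elim (v≢v refl)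

        third-neighbour : ∀ {y} → y ≢ u → y ≢ x → TightPair (decEdge y v K) → TightPair K
        third-neighbour {y} y≢u y≢x Tf = decide (weight Ku Mu <? coverWeight D₁ D₂)
          where
          open TightPair Tf using () renaming (matching to Mf; cover₁ to D₁; cover₂ to D₂;
                                               isMatching to isMatchingf; isCover to isCoverf; tight to tightf)
          Kf : WGraph n₁ n₂
          Kf = decEdge y v K

          Mu-avoids-yv : ∀ {e} → e ∈ Mu → ¬ (proj₁ e ≡ y × proj₂ e ≡ v)
          Mu-avoids-yv e∈ (e₁≡y , e₂≡v) =
            y≢x (trans (sym e₁≡y) (cong proj₁ (matched₂-unique (proj₂ isMatching) e∈ xv∈ e₂≡v)))

          Ku≤Kf-on-Mu : ∀ {e} → e ∈ Mu → wt Ku e ≤ wt Kf e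
          Ku≤Kf-on-Mu {e} e∈ =
            subst (wt Ku e ≤_) (sym (decEdge-off K _ _ (Mu-avoids-yv e∈))) (Ku⊑K (proj₁ e) (proj₂ e))

          Mu-matches-Kf : Matching Kf Mu
          Mu-matches-Kf = All.tabulate (λ e∈ → <-≤-trans (All.lookup (proj₁ isMatching) e∈) (Ku≤Kf-on-Mu e∈)) ,
                          proj₂ isMatching

          -- With u unmatched by Mu, a cover no heavier than Mu must vanish at u; so it already covers (y , v) via v.
          D₁u≡0 : coverWeight D₁ D₂ ≤ weight Ku Mu → D₁ u ≡ 0
          D₁u≡0 light = n≤0⇒n≡0 (+-cancelˡ-≤ (weight Kf Mu) (D₁ u) 0 (begin
            weight Kf Mu + D₁ u ≤⟨ weakDuality-unmatched u Mu-matches-Kf isCoverf u-unmatched ⟩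
            coverWeight D₁ D₂   ≤⟨ light ⟩
            weight Ku Mu        ≤⟨ sum-map-mono-≤ (All.tabulate Ku≤Kf-on-Mu) ⟩
            weight Kf Mu        ≡⟨ +-identityʳ (weight Kf Mu) ⟨
            weight Kf Mu + 0    ∎))
            where open ≤-Reasoning

          covers-K : D₁ u ≡ 0 → IsCover K D₁ D₂
          covers-K D₁u≡0 i j _ with i ≟ᶠ y | j ≟ᶠ v
          ... | yes refl | yes refl = begin
            K i j         ≤⟨ Kuv-max i j ⟩
            K u v         ≡⟨ decEdge-off K u v (y≢u ∘ sym ∘ proj₁) ⟨
            Kf u v        ≤⟨ covers D₁ D₂ isCoverf u v ⟩
            D₁ u + D₂ v   ≡⟨ cong (_+ D₂ v) D₁u≡0 ⟩
            D₂ v          ≤⟨ m≤n+m (D₂ v) (D₁ i) ⟩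
            D₁ i + D₂ j   ∎
            where open ≤-Reasoning
          ... | yes _ | no j≢v = subst (_≤ _) (decEdge-off K i j (j≢v ∘ proj₂)) (covers D₁ D₂ isCoverf i j)
          ... | no i≢y | _ = subst (_≤ _) (decEdge-off K i j (i≢y ∘ proj₁)) (covers D₁ D₂ isCoverf i j)

          decide : Dec (weight Ku Mu < coverWeight D₁ D₂) → TightPair K
          decide (yes lighter) = raise Mf (matching-⊑ (decEdge-⊑ y v K) isMatchingf)
                                   (<-≤-trans lighter (≤-trans tightf (weight-⊑ (decEdge-⊑ y v K) Mf)))
          decide (no ≮) = tightPair Mf D₁ D₂ (matching-⊑ (decEdge-⊑ y v K) isMatchingf) (covers-K (D₁u≡0 (≮⇒≥ ≮)))
                            (≤-trans tightf (weight-⊑ (decEdge-⊑ y v K) Mf))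

  -- Merging rows u and x and deleting column v lowers the total weight, and a tight pair of the merged
  -- graph Kc lifts to K with matching and cover both gaining N.
  module Contraction (K : WGraph n₁ n₂) {u v x} (x≢u : x ≢ u) (Kuv>0 : 0 < K u v) (Kuv-max : ∀ i j → K i j ≤ K u v)
                     (Kxv≡Kuv : K x v ≡ K u v) (column-v : ∀ i → i ≢ u → i ≢ x → K i v ≡ 0) where

    N : ℕ
    N = K u v

    Kc : WGraph n₁ n₂
    Kc i j with j ≟ᶠ v | i ≟ᶠ x | i ≟ᶠ u
    ... | yes _ | _     | _     = 0
    ... | no _  | yes _ | _     = 0
    ... | no _  | no _  | yes _ = K u j ⊔ K x j
    ... | no _  | no _  | no _  = K i j

    Kc-v : ∀ i → Kc i v ≡ 0
    Kc-v i with v ≟ᶠ v | i ≟ᶠ x | i ≟ᶠ u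
    ... | yes _   | _ | _ = refl
    ... | no v≢v  | _ | _ = ⊥-elim (v≢v refl)

    Kc-x : ∀ j → Kc x j ≡ 0
    Kc-x j with j ≟ᶠ v | x ≟ᶠ x | x ≟ᶠ u
    ... | yes _ | _       | _ = refl
    ... | no _  | yes _   | _ = refl
    ... | no _  | no x≢x  | _ = ⊥-elim (x≢x refl)

    Kc-u : ∀ j → j ≢ v → Kc u j ≡ K u j ⊔ K x j
    Kc-u j j≢v with j ≟ᶠ v | u ≟ᶠ x | u ≟ᶠ u
    ... | yes j≡v | _       | _       = ⊥-elim (j≢v j≡v)
    ... | no _    | yes u≡x | _       = ⊥-elim (x≢u (sym u≡x))
    ... | no _    | no _    | yes _   = refl
    ... | no _    | no _    | no u≢u  = ⊥-elim (u≢u refl)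

    Kc-other : ∀ {i} j → j ≢ v → i ≢ x → i ≢ u → Kc i j ≡ K i j
    Kc-other {i} j j≢v i≢x i≢u with j ≟ᶠ v | i ≟ᶠ x | i ≟ᶠ u
    ... | yes j≡v | _       | _       = ⊥-elim (j≢v j≡v)
    ... | no _    | yes i≡x | _       = ⊥-elim (i≢x i≡x)
    ... | no _    | no _    | yes i≡u = ⊥-elim (i≢u i≡u)
    ... | no _    | no _    | no _    = refl

    Kc-edge : ∀ {i j} → 0 < Kc i j → j ≢ v × i ≢ x
    Kc-edge {i} {j} Kcij>0 =
      (λ { refl → <-irrefl (sym (Kc-v i)) Kcij>0 }) , (λ { refl → <-irrefl (sym (Kc-x j)) Kcij>0 })

    Kc<K : totalWeight Kc < totalWeight K
    Kc<K = ∑-mono-<₂ x≢u (λ i i≢u i≢x → ∑-mono-≤ (Kc≤K-off-ux i≢u i≢x)) (begin-strict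
      ∑ (Kc u) + ∑ (Kc x)         ≡⟨ cong (∑ (Kc u) +_) (trans (sum-cong-≗ Kc-x) (sum-replicate-zero n₂)) ⟩
      ∑ (Kc u) + 0                ≡⟨ +-identityʳ (∑ (Kc u)) ⟩
      ∑ (Kc u)                    <⟨ ∑-mono-< v Kc-u≤ (subst (_< K u v + K x v) (sym (Kc-v u))
                                                              (<-≤-trans Kuv>0 (m≤m+n _ _))) ⟩
      ∑ (λ j → K u j + K x j)     ≡⟨ ∑-distrib-+ (K u) (K x) ⟩
      ∑ (K u) + ∑ (K x)           ∎)
      where
      open ≤-Reasoning
      Kc≤K-off-ux : ∀ {i} → i ≢ u → i ≢ x → ∀ j → Kc i j ≤ K i j
      Kc≤K-off-ux {i} i≢u i≢x j = by-cases (j ≟ᶠ v)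
        where
        by-cases : Dec (j ≡ v) → Kc i j ≤ K i j
        by-cases (yes refl) = subst (_≤ K i v) (sym (Kc-v i)) z≤n
        by-cases (no j≢v) = ≤-reflexive (Kc-other j j≢v i≢x i≢u)
      Kc-u≤ : ∀ j → Kc u j ≤ K u j + K x j
      Kc-u≤ j = by-cases (j ≟ᶠ v)
        where
        by-cases : Dec (j ≡ v) → Kc u j ≤ K u j + K x j
        by-cases (yes refl) = subst (_≤ _) (sym (Kc-v u)) z≤n
        by-cases (no j≢v) = subst (_≤ _) (sym (Kc-u j j≢v)) (m⊔n≤m+n (K u j) (K x j))

    module FromContracted (T : TightPair Kc) where
      open TightPair T renaming (matching to Mc)

      -- x gets u's cover capped at N and v the rest of N; (x , j) stays covered as K x j ≤ Kc u j and K x j ≤ N.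
      c : ℕ
      c = cover₁ u ⊓ N

      D₁ : Fin n₁ → ℕ
      D₁ = cover₁ [ x ]≔ c

      D₂ : Fin n₂ → ℕ
      D₂ = cover₂ [ v ]≔ (N ∸ c)

      N≤c+D₂v : N ≤ c + D₂ v
      N≤c+D₂v = subst (λ t → N ≤ c + t) (sym (updateAt-updates v cover₂)) (m≤n+m∸n N c)

      lifted-cover : IsCover K D₁ D₂
      lifted-cover i j _ = by-cases (j ≟ᶠ v) (i ≟ᶠ u) (i ≟ᶠ x)
        where
        open ≤-Reasoning
        D₁-u : D₁ u ≡ cover₁ u
        D₁-u = updateAt-minimal u x cover₁ (x≢u ∘ sym)
        by-cases : Dec (j ≡ v) → Dec (i ≡ u) → Dec (i ≡ x) → K i j ≤ D₁ i + D₂ j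
        by-cases (yes refl) (yes refl) _ = begin
          N             ≤⟨ N≤c+D₂v ⟩
          c + D₂ v      ≤⟨ +-monoˡ-≤ (D₂ v) (m⊓n≤m (cover₁ u) N) ⟩
          cover₁ u + D₂ v ≡⟨ cong (_+ D₂ v) D₁-u ⟨
          D₁ u + D₂ v   ∎
        by-cases (yes refl) (no _) (yes refl) = begin
          K x v         ≡⟨ Kxv≡Kuv ⟩
          N             ≤⟨ N≤c+D₂v ⟩
          c + D₂ v      ≡⟨ cong (_+ D₂ v) (updateAt-updates x cover₁) ⟨
          D₁ x + D₂ v   ∎
        by-cases (yes refl) (no i≢u) (no i≢x) = subst (_≤ D₁ i + D₂ v) (sym (column-v i i≢u i≢x)) z≤n
        by-cases (no j≢v) (yes refl) _ = begin
          K u j                ≤⟨ m≤m⊔n (K u j) (K x j) ⟩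
          K u j ⊔ K x j        ≡⟨ Kc-u j j≢v ⟨
          Kc u j               ≤⟨ covers cover₁ cover₂ isCover u j ⟩
          cover₁ u + cover₂ j  ≡⟨ cong₂ _+_ D₁-u (updateAt-minimal j v cover₂ j≢v) ⟨
          D₁ u + D₂ j          ∎
        by-cases (no j≢v) (no _) (yes refl) = begin
          K x j                ≤⟨ ≤⊓+ {b = cover₁ u} (≤-trans (m≤n⊔m (K u j) (K x j))
                                                        (subst (_≤ _) (Kc-u j j≢v) (covers cover₁ cover₂ isCover u j)))
                                      (Kuv-max x j) ⟩
          c + cover₂ j         ≡⟨ cong₂ _+_ (updateAt-updates x cover₁) (updateAt-minimal j v cover₂ j≢v) ⟨
          D₁ x + D₂ j          ∎
        by-cases (no j≢v) (no i≢u) (no i≢x) = begin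
          K i j                ≡⟨ Kc-other j j≢v i≢x i≢u ⟨
          Kc i j               ≤⟨ covers cover₁ cover₂ isCover i j ⟩
          cover₁ i + cover₂ j  ≡⟨ cong₂ _+_ (updateAt-minimal i x cover₁ i≢x) (updateAt-minimal j v cover₂ j≢v) ⟨
          D₁ i + D₂ j          ∎

      lifted-weight : coverWeight D₁ D₂ ≤ coverWeight cover₁ cover₂ + N
      lifted-weight = begin
        coverWeight D₁ D₂                       ≡⟨ coverWeight-∑ D₁ D₂ ⟩
        ∑ D₁ + ∑ D₂                             ≤⟨ +-mono-≤ (∑-[]≔-≤ cover₁ x c) (∑-[]≔-≤ cover₂ v (N ∸ c)) ⟩
        (∑ cover₁ + c) + (∑ cover₂ + (N ∸ c))   ≡⟨ +-interchange (∑ cover₁) c (∑ cover₂) (N ∸ c) ⟩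
        (∑ cover₁ + ∑ cover₂) + (c + (N ∸ c))   ≡⟨ cong₂ _+_ (coverWeight-∑ cover₁ cover₂)
                                                              (sym (m+[n∸m]≡n (m⊓n≤n (cover₁ u) N))) ⟨
        coverWeight cover₁ cover₂ + N           ∎
        where open ≤-Reasoning

      HeavyMatching : Set
      HeavyMatching = Σ (List Edge) λ M → Matching K M × N + weight Kc Mc ≤ weight K M

      Mc-edge : ∀ {e} → e ∈ Mc → proj₂ e ≢ v × proj₁ e ≢ x
      Mc-edge e∈ = Kc-edge (All.lookup (proj₁ isMatching) e∈)

      heavy-u-unmatched : ¬ Any (λ e → proj₁ e ≡ u) Mc → HeavyMatching
      heavy-u-unmatched u∉ = (u , v) ∷ Mc , (Kuv>0 ∷ edges , disjoint ∷ proj₂ isMatching) ,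
                             +-monoʳ-≤ N (sum-map-mono-≤ (All.tabulate (≤-reflexive ∘ Kc≡K)))
        where
        u-unmatched : All (λ e → proj₁ e ≢ u) Mc
        u-unmatched = ¬Any⇒All¬ Mc u∉
        Kc≡K : ∀ {e} → e ∈ Mc → wt Kc e ≡ wt K e
        Kc≡K e∈ = Kc-other _ (proj₁ (Mc-edge e∈)) (proj₂ (Mc-edge e∈)) (All.lookup u-unmatched e∈)
        edges : All (IsEdge K) Mc
        edges = All.tabulate λ e∈ → subst (0 <_) (Kc≡K e∈) (All.lookup (proj₁ isMatching) e∈)
        disjoint : All (Disjoint (u , v)) Mc
        disjoint = All.tabulate λ e∈ → All.lookup u-unmatched e∈ ∘ sym , proj₁ (Mc-edge e∈) ∘ sym

      -- The edge (u , y) goes to whichever of u, x is heavier at y, and the other one takes v.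
      heavy-u-matched : ∀ {a y} → (a , y) ∈ Mc → a ≡ u → ∀ p q → (p ≡ u × q ≡ x) ⊎ (p ≡ x × q ≡ u) →
                        K p y ≡ K u y ⊔ K x y → HeavyMatching
      heavy-u-matched {y = y} uy∈ refl p q pq Kpy≡ = (q , v) ∷ map (redirect p y) Mc ,
        (Kqv>0 ∷ Allₚ.map⁺ (All.tabulate edge) ,
         Allₚ.map⁺ (All.tabulate disjoint) ∷ redirect-disjoint p-matched (proj₂ isMatching)) ,
        +-mono-≤ (≤-reflexive (sym Kqv≡N))
          (subst (weight Kc Mc ≤_) (cong sum (map-∘ {g = wt K} {f = redirect p y} Mc))
            (sum-map-mono-≤ (All.tabulate (≤-reflexive ∘ moved-weight))))
        where
        Kqv≡N : K q v ≡ N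
        Kqv≡N = [ (λ { (_ , refl) → Kxv≡Kuv }) , (λ { (_ , refl) → refl }) ]′ pq
        Kqv>0 : 0 < K q v
        Kqv>0 = subst (0 <_) (sym Kqv≡N) Kuv>0
        p≢q : p ≢ q
        p≢q = [ (λ { (refl , refl) → x≢u ∘ sym }) , (λ { (refl , refl) → x≢u }) ]′ pq
        q∉others : ∀ {i} → i ≢ u → i ≢ x → q ≢ i
        q∉others i≢u i≢x = [ (λ { (_ , refl) → i≢x ∘ sym }) , (λ { (_ , refl) → i≢u ∘ sym }) ]′ pq
        y≢v : y ≢ v
        y≢v = proj₁ (Mc-edge uy∈)
        off-row-u : ∀ {e} → e ∈ Mc → proj₂ e ≢ y → proj₁ e ≢ u
        off-row-u e∈ e₂≢y e₁≡u = e₂≢y (cong proj₂ (matched₁-unique (proj₂ isMatching) e∈ uy∈ e₁≡u))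
        moved-weight : ∀ {e} → e ∈ Mc → wt Kc e ≡ wt K (redirect p y e)
        moved-weight {e} e∈ with proj₂ e ≟ᶠ y
        ... | yes e₂≡y =
          trans (cong (wt Kc) (matched₂-unique (proj₂ isMatching) e∈ uy∈ e₂≡y)) (trans (Kc-u y y≢v) (sym Kpy≡))
        ... | no e₂≢y = Kc-other _ (proj₁ (Mc-edge e∈)) (proj₂ (Mc-edge e∈)) (off-row-u e∈ e₂≢y)
        edge : ∀ {e} → e ∈ Mc → IsEdge K (redirect p y e)
        edge e∈ = subst (0 <_) (moved-weight e∈) (All.lookup (proj₁ isMatching) e∈)
        disjoint : ∀ {e} → e ∈ Mc → Disjoint (q , v) (redirect p y e)
        disjoint {e} e∈ with proj₂ e ≟ᶠ y
        ... | yes _ = p≢q ∘ sym , y≢v ∘ sym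
        ... | no e₂≢y = q∉others (off-row-u e∈ e₂≢y) (proj₂ (Mc-edge e∈)) , proj₁ (Mc-edge e∈) ∘ sym
        p-matched : All (λ e → proj₁ e ≡ p → proj₂ e ≡ y) Mc
        p-matched = All.tabulate λ {e} e∈ e₁≡p →
          [ (λ { (refl , _) → cong proj₂ (matched₁-unique (proj₂ isMatching) e∈ uy∈ e₁≡p) })
          , (λ { (refl , _) → ⊥-elim (proj₂ (Mc-edge e∈) e₁≡p) }) ]′ pq

      heavy : HeavyMatching
      heavy with Any.any? (λ e → proj₁ e ≟ᶠ u) Mc
      ... | no u∉ = heavy-u-unmatched u∉
      ... | yes u∈ with find u∈
      ...   | (a , y) , ay∈ , a≡u with K x y ≤? K u y
      ...     | yes Kxy≤Kuy = heavy-u-matched ay∈ a≡u u x (inj₁ (refl , refl)) (sym (m≥n⇒m⊔n≡m Kxy≤Kuy))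
      ...     | no Kxy≰Kuy = heavy-u-matched ay∈ a≡u x u (inj₂ (refl , refl)) (sym (m≤n⇒m⊔n≡n (<⇒≤ (≰⇒> Kxy≰Kuy))))

      lift : TightPair K
      lift = tightPair (proj₁ heavy) D₁ D₂ (proj₁ (proj₂ heavy)) lifted-cover (begin
        coverWeight D₁ D₂               ≤⟨ lifted-weight ⟩
        coverWeight cover₁ cover₂ + N   ≤⟨ +-monoˡ-≤ N tight ⟩
        weight Kc Mc + N                ≡⟨ +-comm (weight Kc Mc) N ⟩
        N + weight Kc Mc                ≤⟨ proj₂ (proj₂ heavy) ⟩
        weight K (proj₁ heavy)          ∎)
        where open ≤-Reasoning

  egerváry : ∀ (K : WGraph n₁ n₂) → TightPair K
  egerváry = WF.All.wfRec (On.wellFounded totalWeight <-wellFounded) 0ℓ TightPair step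
    where
    step : ∀ K → (∀ {K′} → totalWeight K′ < totalWeight K → TightPair K′) → TightPair K
    step K ih with maxEdge K
    ... | inj₁ K≡0 = tightPair-empty K≡0
    ... | inj₂ (u , v , Kuv>0 , Kuv-max) = by-cases
      where
      open MaxEdge K Kuv>0 Kuv-max
      open FromDecremented (ih Ku<K)

      Mu : List Edge
      Mu = TightPair.matching (ih Ku<K)

      by-partner : ¬ Any (λ e → proj₁ e ≡ u) Mu → ∀ {x} → (x , v) ∈ Mu → TightPair K
      by-partner u∉ {x} xv∈ with any? (λ y → ¬? (y ≟ᶠ u) ×-dec ¬? (y ≟ᶠ x) ×-dec 0 <? K y v)
      ... | yes (y , y≢u , y≢x , Kyv>0) = third-neighbour u∉ xv∈ y≢u y≢x (ih (decEdge-< K Kyv>0))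
      ... | no no-third with K x v <? K u v
      ...   | yes Kxv<Kuv = partner-lighter u∉ xv∈ Kxv<Kuv
      ...   | no Kxv≮Kuv = FromContracted.lift (ih Kc<K)
        where
        open Contraction K (x≢u u∉ xv∈) Kuv>0 Kuv-max (≤-antisym (Kuv-max x v) (≮⇒≥ Kxv≮Kuv))
                         (λ i i≢u i≢x → n≤0⇒n≡0 (≮⇒≥ λ Kiv>0 → no-third (i , i≢u , i≢x , Kiv>0)))

      by-cases : TightPair K
      by-cases with Any.any? (λ e → proj₁ e ≟ᶠ u) Mu
      ... | yes u∈ = u-matched u∈
      ... | no u∉ with Any.any? (λ e → proj₂ e ≟ᶠ v) Mu
      ...   | no v∉ = u-v-unmatched u∉ v∉
      ...   | yes v∈ with find v∈
      ...     | (x , _) , xv∈ , refl = by-partner u∉ xv∈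

  mwm≡minCover : ∀ {K M C₁ C₂} → IsMWM K M → IsMinCover K C₁ C₂ → weight K M ≡ coverWeight C₁ C₂
  mwm≡minCover {K} (isMWM , optimal) (isCover , minimal) with egerváry K
  ... | tightPair M′ D₁ D₂ isMatching′ isCover′ tight′ =
    ≤-antisym (weakDuality (isMatching⇒matching isMWM) isCover)
              (≤-trans (minimal D₁ D₂ isCover′) (≤-trans tight′ (optimal M′ (matching⇒isMatching isMatching′))))

  mwm-cover : ∀ {K M} → IsMWM K M → ∃₂ λ D₁ D₂ → IsCover K D₁ D₂ × coverWeight D₁ D₂ ≤ weight K M
  mwm-cover {K} (_ , optimal) with egerváry K
  ... | tightPair M′ D₁ D₂ isMatching′ isCover′ tight′ =
    D₁ , D₂ , isCover′ , ≤-trans tight′ (optimal M′ (matching⇒isMatching isMatching′))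

-- Threshold graphs

module Threshold {n₁ n₂} (W : WGraph n₁ n₂) {N H₂ h : ℕ} (W≤N : ∀ i j → W i j ≤ N) (H₂<N : H₂ < N)
                 (gap : ∀ i j → W i j < N → W i j ≤ H₂) (h≥1 : 1 ≤ h) (h≤N∸H₂ : h ≤ N ∸ H₂) where

  G : WGraph n₁ n₂
  G = Gh N h W

  h≤N : h ≤ N
  h≤N = ≤-trans h≤N∸H₂ (m∸n≤m N H₂)

  H₂≤N∸h : H₂ ≤ N ∸ h
  H₂≤N∸h = m+n≤o⇒m≤o∸n H₂ (subst (_≤ N) (+-comm h H₂) (m≤o∸n⇒m+n≤o h (<⇒≤ H₂<N) h≤N∸H₂))

  above-threshold⇒max : ∀ {i j} → N ∸ h < W i j → W i j ≡ N
  above-threshold⇒max {i} {j} N∸h<W = ≤-antisym (W≤N i j) (≮⇒≥ λ W<N → <⇒≱ N∸h<W (≤-trans (gap i j W<N) H₂≤N∸h))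

  G-above : ∀ {i j} → N ∸ h < W i j → G i j ≡ h
  G-above {i} {j} N∸h<W = begin
    G i j               ≡⟨ cong (λ b → if b then W i j ∸ (N ∸ h) else 0) (dec-true (N ∸ h <? W i j) N∸h<W) ⟩
    W i j ∸ (N ∸ h)     ≡⟨ cong (_∸ (N ∸ h)) (above-threshold⇒max N∸h<W) ⟩
    N ∸ (N ∸ h)         ≡⟨ m∸[m∸n]≡n h≤N ⟩
    h                   ∎
    where open ≡-Reasoning

  G-below : ∀ {i j} → ¬ (N ∸ h < W i j) → G i j ≡ 0
  G-below {i} {j} N∸h≮W = cong (λ b → if b then W i j ∸ (N ∸ h) else 0) (dec-false (N ∸ h <? W i j) N∸h≮W)

  G-edge : ∀ {i j} → 0 < G i j → W i j ≡ N × G i j ≡ h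
  G-edge {i} {j} Gij>0 with N ∸ h <? W i j
  ... | yes N∸h<W = above-threshold⇒max N∸h<W , G-above N∸h<W
  ... | no N∸h≮W = ⊥-elim (<-irrefl (sym (G-below N∸h≮W)) Gij>0)

  G-max : ∀ {i j} → W i j ≡ N → G i j ≡ h
  G-max W≡N = G-above (subst (_ <_) (sym W≡N) (∸-monoʳ-< h≥1 h≤N))

  G-weight : ∀ M → All (IsEdge G) M → weight G M ≡ h * length M
  G-weight [] [] = sym (*-zeroʳ h)
  G-weight (e ∷ M) (e>0 ∷ M>0) = trans (cong₂ _+_ (proj₂ (G-edge e>0)) (G-weight M M>0)) (sym (*-suc h (length M)))

  mwm⇔mm : ∀ M → IsMWM G M ⇔ IsMM G M
  mwm⇔mm = uniform-mwm⇔mm h≥1 G-weight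

  module Residual (C₁ : Fin n₁ → ℕ) (C₂ : Fin n₂ → ℕ) (minC : IsMinCover G C₁ C₂) where

    minCover≡h*mm : ∀ {Mh} → IsMM G Mh → coverWeight C₁ C₂ ≡ h * length Mh
    minCover≡h*mm {Mh} mm =
      trans (sym (mwm≡minCover (Equivalence.from (mwm⇔mm Mh) mm) minC)) (G-weight Mh (proj₁ (proj₁ mm)))

    Δ : WGraph n₁ n₂
    Δ = GΔ W C₁ C₂

    h≤C : ∀ {i j} → W i j ≡ N → h ≤ C₁ i + C₂ j
    h≤C {i} {j} W≡N = subst (_≤ _) (G-max W≡N) (covers C₁ C₂ (proj₁ minC) i j)

    Δ≤N∸h : ∀ i j → Δ i j ≤ N ∸ h
    Δ≤N∸h i j with W i j <? N
    ... | yes W<N = ≤-trans (m∸n≤m (W i j) (C₁ i + C₂ j)) (≤-trans (gap i j W<N) H₂≤N∸h)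
    ... | no W≮N = ∸-mono (W≤N i j) (h≤C (≤-antisym (W≤N i j) (≮⇒≥ W≮N)))

    module _ {MΔ} (mwmΔ : IsMWM Δ MΔ) where

      R : ℕ
      R = coverWeight C₁ C₂ + weight Δ MΔ

      R≤split : ∀ {A₁ A₂} P₁ P₂ Q₁ Q₂ → IsCover G P₁ P₂ → IsCover Δ Q₁ Q₂ →
                (∀ u → P₁ u + Q₁ u ≡ A₁ u) → (∀ v → P₂ v + Q₂ v ≡ A₂ v) → R ≤ coverWeight A₁ A₂
      R≤split {A₁} {A₂} P₁ P₂ Q₁ Q₂ coverP coverQ split₁ split₂ = begin
        R                                                    ≤⟨ +-mono-≤ (proj₂ minC P₁ P₂ coverP)
                                                                   (weakDuality (isMatching⇒matching (proj₁ mwmΔ))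
                                                                                coverQ) ⟩
        coverWeight P₁ P₂ + coverWeight Q₁ Q₂                ≡⟨ coverWeight-+ P₁ Q₁ P₂ Q₂ ⟨
        coverWeight (λ u → P₁ u + Q₁ u) (λ v → P₂ v + Q₂ v)  ≡⟨ coverWeight-cong split₁ split₂ ⟩
        coverWeight A₁ A₂                                    ∎
        where open ≤-Reasoning

      -- The residual taken from the dominating side is capped at N ∸ h ≥ Δ, so the rest still covers the h-edges.
      split-right : ∀ A₁ A₂ → IsCover W A₁ A₂ → (∀ v → C₂ v ≤ A₂ v) → R ≤ coverWeight A₁ A₂
      split-right A₁ A₂ coverA C₂≤A₂ =
        R≤split (λ u → C₁ u ⊓ A₁ u) (λ v → A₂ v ∸ Q₂ v) (λ u → A₁ u ∸ C₁ u) Q₂ coverP coverQ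
                (λ u → m⊓n+n∸m≡n (C₁ u) (A₁ u)) (λ v → m∸n+n≡m (Q₂≤A₂ v))
        where
        Q₂ : Fin n₂ → ℕ
        Q₂ v = (A₂ v ∸ C₂ v) ⊓ (N ∸ h)
        Q₂≤A₂ : ∀ v → Q₂ v ≤ A₂ v
        Q₂≤A₂ v = ≤-trans (m⊓n≤m _ (N ∸ h)) (m∸n≤m (A₂ v) (C₂ v))
        coverP : IsCover G (λ u → C₁ u ⊓ A₁ u) (λ v → A₂ v ∸ Q₂ v)
        coverP i j Gij>0 with G-edge Gij>0
        ... | W≡N , G≡h = subst (_≤ _) (sym G≡h)
                            (≤-split-min (C₂≤A₂ j) (h≤C W≡N) (subst (_≤ _) W≡N (covers A₁ A₂ coverA i j)) h≤N)
        coverQ : IsCover Δ (λ u → A₁ u ∸ C₁ u) Q₂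
        coverQ i j _ = ∸-split-min (A₁ i) (A₂ j) (C₁ i) (C₂ j) (Δ≤N∸h i j) (covers A₁ A₂ coverA i j)

      split-left : ∀ A₁ A₂ → IsCover W A₁ A₂ → (∀ u → C₁ u ≤ A₁ u) → R ≤ coverWeight A₁ A₂
      split-left A₁ A₂ coverA C₁≤A₁ =
        R≤split (λ u → A₁ u ∸ Q₁ u) (λ v → C₂ v ⊓ A₂ v) Q₁ (λ v → A₂ v ∸ C₂ v) coverP coverQ
                (λ u → m∸n+n≡m (Q₁≤A₁ u)) (λ v → m⊓n+n∸m≡n (C₂ v) (A₂ v))
        where
        Q₁ : Fin n₁ → ℕ
        Q₁ u = (A₁ u ∸ C₁ u) ⊓ (N ∸ h)
        Q₁≤A₁ : ∀ u → Q₁ u ≤ A₁ u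
        Q₁≤A₁ u = ≤-trans (m⊓n≤m _ (N ∸ h)) (m∸n≤m (A₁ u) (C₁ u))
        coverP : IsCover G (λ u → A₁ u ∸ Q₁ u) (λ v → C₂ v ⊓ A₂ v)
        coverP i j Gij>0 with G-edge Gij>0
        ... | W≡N , G≡h = subst₂ _≤_ (sym G≡h) (+-comm (C₂ j ⊓ A₂ j) (A₁ i ∸ Q₁ i))
                            (≤-split-min (C₁≤A₁ i) (subst (h ≤_) (+-comm (C₁ i) (C₂ j)) (h≤C W≡N))
                               (subst₂ _≤_ W≡N (+-comm (A₁ i) (A₂ j)) (covers A₁ A₂ coverA i j)) h≤N)
        coverQ : IsCover Δ Q₁ (λ v → A₂ v ∸ C₂ v)
        coverQ i j _ = subst₂ _≤_ (cong (W i j ∸_) (+-comm (C₂ j) (C₁ i))) (+-comm (A₂ j ∸ C₂ j) (Q₁ i))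
                         (∸-split-min (A₂ j) (A₁ i) (C₂ j) (C₁ i)
                                      (subst (_≤ N ∸ h) (cong (W i j ∸_) (+-comm (C₁ i) (C₂ j))) (Δ≤N∸h i j))
                                      (subst (W i j ≤_) (+-comm (A₁ i) (A₂ j)) (covers A₁ A₂ coverA i j)))

      raised : ∃₂ λ F₁ F₂ → IsCover W F₁ F₂ × (∀ u → C₁ u ≤ F₁ u) × (∀ v → C₂ v ≤ F₂ v) × coverWeight F₁ F₂ ≤ R
      raised with mwm-cover mwmΔ
      ... | E₁ , E₂ , coverE , E≤MΔ = (λ u → C₁ u + E₁ u) , (λ v → C₂ v + E₂ v) , residual-cover C₁ C₂ E₁ E₂ coverE ,
            (λ u → m≤m+n (C₁ u) (E₁ u)) , (λ v → m≤m+n (C₂ v) (E₂ v)) ,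
            ≤-trans (≤-reflexive (coverWeight-+ C₁ E₁ C₂ E₂)) (+-monoʳ-≤ (coverWeight C₁ C₂) E≤MΔ)

      -- Both (D ⊓ F , D ⊔ F) and (D ⊔ F , D ⊓ F) weigh at least R, and together they weigh cw D + cw F.
      R≤cover : ∀ D₁ D₂ → IsCover W D₁ D₂ → R ≤ coverWeight D₁ D₂
      R≤cover D₁ D₂ coverD with raised
      ... | F₁ , F₂ , coverF , C₁≤F₁ , C₂≤F₂ , F≤R = +-cancelʳ-≤ R R (coverWeight D₁ D₂) (begin
        R + R
          ≤⟨ +-mono-≤ (split-right (λ u → D₁ u ⊓ F₁ u) (λ v → D₂ v ⊔ F₂ v) (cover-⊓⊔ D₁ D₂ F₁ F₂ coverD coverF)
                                   (λ v → ≤-trans (C₂≤F₂ v) (m≤n⊔m (D₂ v) (F₂ v))))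
                      (split-left (λ u → D₁ u ⊔ F₁ u) (λ v → D₂ v ⊓ F₂ v) (cover-⊔⊓ D₁ D₂ F₁ F₂ coverD coverF)
                                  (λ u → ≤-trans (C₁≤F₁ u) (m≤n⊔m (D₁ u) (F₁ u)))) ⟩
        coverWeight (λ u → D₁ u ⊓ F₁ u) (λ v → D₂ v ⊔ F₂ v) + coverWeight (λ u → D₁ u ⊔ F₁ u) (λ v → D₂ v ⊓ F₂ v)
          ≡⟨ coverWeight-⊓⊔ D₁ F₁ D₂ F₂ ⟩
        coverWeight D₁ D₂ + coverWeight F₁ F₂
          ≤⟨ +-monoʳ-≤ (coverWeight D₁ D₂) F≤R ⟩
        coverWeight D₁ D₂ + R ∎)
        where open ≤-Reasoning

      mwm≡R : ∀ {M} → IsMWM W M → weight W M ≡ R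
      mwm≡R (isMWM , optimal) with raised | mwm-cover (isMWM , optimal)
      ... | F₁ , F₂ , coverF , _ , _ , F≤R | D₁ , D₂ , coverD , D≤M =
        ≤-antisym (≤-trans (weakDuality (isMatching⇒matching isMWM) coverF) F≤R) (≤-trans (R≤cover D₁ D₂ coverD) D≤M)

theorem2 : ∀ {n₁ n₂ : ℕ} (W : WGraph n₁ n₂) (H₁ H₂ : ℕ) →
    (∃₂ λ i j → W i j ≡ H₁) → 0 < H₁ → (∀ i j → W i j ≤ H₁) →
    H₂ < H₁ → (H₂ ≡ 0 ⊎ ∃₂ λ i j → W i j ≡ H₂) → (∀ i j → W i j < H₁ → W i j ≤ H₂) →
    ∀ (h : ℕ) → 1 ≤ h → h ≤ H₁ ∸ H₂ →
      (∀ (M : List (Fin n₁ × Fin n₂)) → IsMWM (Gh H₁ h W) M ⇔ IsMM (Gh H₁ h W) M)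
      ×
      (∀ (C₁ : Fin n₁ → ℕ) (C₂ : Fin n₂ → ℕ) → IsMinCover (Gh H₁ h W) C₁ C₂ →
        ∀ (M Mh MΔ : List (Fin n₁ × Fin n₂)) →
          IsMWM W M → IsMM (Gh H₁ h W) Mh → IsMWM (GΔ W C₁ C₂) MΔ →
          weight W M ≡ h * length Mh + weight (GΔ W C₁ C₂) MΔ)
theorem2 W H₁ H₂ _ _ W≤H₁ H₂<H₁ _ gap h h≥1 h≤H₁∸H₂ =
  mwm⇔mm , λ C₁ C₂ minC M Mh MΔ mwm mm mwmΔ → let open Residual C₁ C₂ minC in begin
    weight W M                                  ≡⟨ mwm≡R mwmΔ mwm ⟩
    coverWeight C₁ C₂ + weight (GΔ W C₁ C₂) MΔ  ≡⟨ cong (_+ weight (GΔ W C₁ C₂) MΔ) (minCover≡h*mm mm) ⟩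
    h * length Mh + weight (GΔ W C₁ C₂) MΔ      ∎
  where
  open Threshold W W≤H₁ H₂<H₁ gap h≥1 h≤H₁∸H₂
  open ≡-Reasoning
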